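{- No member of $\mathcal{P}_{\mathrm{GS}(3)}$ has $4$-$\mathrm{HOP}_2$, and $\mathcal{P}_{\mathrm{GS}(3)}$ is not quadratically atomic.
   Context: For $1\le i\le n$ let $H_i=\{x\in\mathbb{F}_3^n:x_1=\dots=x_i=0\}$, $e_i$ the $i$-th standard basis vector, $A_{\mathrm{GS}}(n,3)=\bigcup_{i=1}^n(H_i+e_i)$; $\mathcal{P}_{\mathrm{GS}(3)}$ is the closure of $\{(\mathbb{F}_3^n,A_{\mathrm{GS}}(n,3)):n\ge1\}$ under isomorphism of pairs (bijections $f$ with $f(x+y)=f(x)-f(0)+f(y)$ preserving the distinguished sets). A pair $(G,A)$ has $k$-$\mathrm{HOP}_2$ if there are $a_1,\dots,a_k,b_1,\dots,b_k,c_1,\dots,c_k\in G$ with $a_u+b_v+c_w\in A\iff u<v+w$. A quadratic factor $(\mathcal{L},\mathcal{Q})$ in $\mathbb{F}_3^n$ consists of vectors $\mathcal{L}=\{v_1,\dots,v_\ell\}$ and symmetric matrices $\mathcal{Q}=\{M_1,\dots,M_q\}$; its atoms are $\{x:x^Tv_i=r_i,x^TM_jx=s_j\}$, complexity $(\dim\operatorname{span}\mathcal{L},q)$, rank the minimum rank of a nontrivial combination of the $M_j$. A rank function is strictly increasing $\mathbb{N}\to\mathbb{R}^+$. An isomorphism-closed class $\mathcal{P}$ of pairs (finite elementary abelian $3$-group, subset) is quadratically atomic if for all $\epsilon>0$ and rank functions $\rho$ there are $D,N$ such that for all $n\ge N$ and $(G,A)\in\mathcal{P}$ with $|G|\ge3^n$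 there is a quadratic factor in $G$ of complexity $(\ell,q)$, $\ell+q\le D$, rank $\ge\rho(\ell+q)$, every atom $B$ of which has $|A\cap B|/|B|\in[0,\epsilon)\cup(1-\epsilon,1]$. -}

module Defs where

open import Data.Nat as ℕ using (ℕ; zero; suc; _+_; _^_)
open import Data.Fin using (Fin; zero; suc; toℕ)
import Data.Fin.Properties as FinP
open import Data.Vec using (Vec; []; _∷_; zipWith; map; foldr; replicate; tabulate; lookup)
import Data.Vec.Properties as VecP
open import Data.Vec.Relation.Unary.All using (All)
open import Data.List using (List; length; filter; concatMap) renaming ([] to []ₗ; _∷_ to _∷ₗ_; map to mapₗ)
open import Data.Bool using (Bool; true; false; _∧_; T)
open import Data.Product using (Σ; _×_; _,_; ∃)
open import Data.Sum using (_⊎_)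
open import Data.Integer using (+_)
open import Data.Rational as ℚ using (ℚ; _/_; 0ℚ; 1ℚ)
open import Function.Bundles using (_⤖_; Bijection)
open import Relation.Nullary using (¬_; Dec)
open import Relation.Nullary.Decidable using (⌊_⌋)
open import Relation.Binary.PropositionalEquality using (_≡_; _≢_)
open import Relation.Unary using (Decidable)

F₃ : Set
F₃ = Fin 3

_+₃_ : F₃ → F₃ → F₃
zero +₃ y = y
suc zero +₃ zero = suc zero
suc zero +₃ suc zero = suc (suc zero)
suc zero +₃ suc (suc zero) = zero
suc (suc zero) +₃ zero = suc (suc zero)
suc (suc zero) +₃ suc zero = zero
suc (suc zero) +₃ suc (suc zero) = suc zero

-₃_ : F₃ → F₃
-₃ zero = zero
-₃ suc zero = suc (suc zero)
-₃ suc (suc zero) = suc zero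

_*₃_ : F₃ → F₃ → F₃
zero *₃ y = zero
suc zero *₃ y = y
suc (suc zero) *₃ y = -₃ y

V : ℕ → Set
V n = Vec F₃ n

_⊕_ : ∀ {n} → V n → V n → V n
_⊕_ = zipWith _+₃_

_⊖_ : ∀ {n} → V n → V n → V n
x ⊖ y = x ⊕ map -₃_ y

𝟎 : ∀ {n} → V n
𝟎 = replicate _ zero

_·_ : F₃ → ∀ {n} → V n → V n
c · x = map (c *₃_) x

dot : ∀ {n} → V n → V n → F₃
dot x v = foldr _ _+₃_ zero (zipWith _*₃_ x v)

allF₃ : List F₃
allF₃ = zero ∷ₗ suc zero ∷ₗ suc (suc zero) ∷ₗ []ₗ

allV : (n : ℕ) → List (V n)
allV zero = [] ∷ₗ []ₗ
allV (suc n) = concatMap (λ c → mapₗ (c ∷_) (allV n)) allF₃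

_≟V_ : ∀ {n} (x y : V n) → Dec (x ≡ y)
_≟V_ = VecP.≡-dec FinP._≟_

-- The set A_GS(n,3) = ⋃_{i=1}^n (H_i + e_i), where
-- H_i = {x : x_1 = … = x_i = 0}.  With 0-indexed i ∈ Fin n,
-- x ∈ H_{i+1} + e_{i+1} iff x_j = 0 for j < i and x_i = 1.

inAGS : ∀ {n} → V n → Bool
inAGS [] = false
inAGS (zero ∷ x) = inAGS x
inAGS (suc zero ∷ x) = true
inAGS (suc (suc zero) ∷ x) = false

Subset : ℕ → Set
Subset m = V m → Bool

PairIso : (n : ℕ) → Subset n → (m : ℕ) → Subset m → Set
PairIso n A m A′ =
  Σ (V n ⤖ V m) λ f →
    let to = Bijection.to f in
    (∀ x y → to (x ⊕ y) ≡ (to x ⊖ to 𝟎) ⊕ to y) ×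
    (∀ x → A′ (to x) ≡ A x)

InPGS3 : (m : ℕ) → Subset m → Set
InPGS3 m A = Σ ℕ λ n → (1 ℕ.≤ n) × PairIso n inAGS m A

-- k-HOP₂ (indices u,v,w range over 1..k; Fin k is 0-indexed, so shift)

HasHOP₂ : (k : ℕ) → (m : ℕ) → Subset m → Set
HasHOP₂ k m A =
  Σ (Fin k → V m) λ a → Σ (Fin k → V m) λ b → Σ (Fin k → V m) λ c →
    ∀ u v w →
      (A ((a u ⊕ b v) ⊕ c w) ≡ true → suc (toℕ u) ℕ.< suc (toℕ v) + suc (toℕ w)) ×
      (suc (toℕ u) ℕ.< suc (toℕ v) + suc (toℕ w) → A ((a u ⊕ b v) ⊕ c w) ≡ true)

lincomb : ∀ {m k} → Vec F₃ k → Vec (V m) k → V m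
lincomb [] [] = 𝟎
lincomb (c ∷ cs) (v ∷ vs) = (c · v) ⊕ lincomb cs vs

InSpan : ∀ {m k} → Vec (V m) k → V m → Set
InSpan {k = k} vs x = Σ (Vec F₃ k) λ c → lincomb c vs ≡ x

LinIndep : ∀ {m k} → Vec (V m) k → Set
LinIndep {k = k} ws = ∀ (c : Vec F₃ k) → lincomb c ws ≡ 𝟎 → c ≡ 𝟎

HasDim : ∀ {m k} → Vec (V m) k → ℕ → Set
HasDim {m} vs d =
  Σ (Vec (V m) d) λ ws →
    LinIndep ws × All (InSpan vs) ws × All (InSpan ws) vs

Mat : ℕ → Set
Mat m = Fin m → Fin m → F₃

Symmetric : ∀ {m} → Mat m → Set
Symmetric M = ∀ i j → M i j ≡ M j i

columns : ∀ {m} → Mat m → Vec (V m) m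
columns M = tabulate (λ j → tabulate (λ i → M i j))

HasRank : ∀ {m} → Mat m → ℕ → Set
HasRank M r = HasDim (columns M) r

matVec : ∀ {m} → Mat m → V m → V m
matVec M x = tabulate (λ i → dot (tabulate (M i)) x)

quadForm : ∀ {m} → V m → Mat m → F₃
quadForm x M = dot x (matVec M x)

matComb : ∀ {m q} → Vec F₃ q → Vec (Mat m) q → Mat m
matComb [] [] = λ _ _ → zero
matComb (c ∷ cs) (M ∷ Ms) = λ i j → (c *₃ M i j) +₃ matComb cs Ms i j

record QuadFactor (m : ℕ) : Set where
  field
    ℓ₀ : ℕ
    q  : ℕ
    L  : Vec (V m) ℓ₀
    Q  : Vec (Mat m) q
    Qsym : All Symmetric Q

open QuadFactor public

inAtom : ∀ {m} (F : QuadFactor m) → Vec F₃ (ℓ₀ F) → Vec F₃ (q F) → V m → Bool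
inAtom F r s x =
  ⌊ map (dot x) (L F) ≟V r ⌋ ∧ ⌊ map (quadForm x) (Q F) ≟V s ⌋

RankAtLeast : ∀ {m} → QuadFactor m → ℚ → Set
RankAtLeast F R =
  ∀ (c : Vec F₃ (q F)) → c ≢ 𝟎 → ∀ r → HasRank (matComb c (Q F)) r → R ℚ.≤ (+ r / 1)

count : ∀ {m} → (V m → Bool) → ℕ
count {m} P = length (filter (λ x → T? (P x)) (allV m))
  where
    T? : (b : Bool) → Dec (T b)
    T? = Data.Bool.T?
      where import Data.Bool

-- the ratio a/b (only used for b ≠ 0)
ratio : ℕ → ℕ → ℚ
ratio a zero = 0ℚ
ratio a (suc b) = (+ a) / suc b

AtomsNearlyDecided : ∀ {m} → Subset m → QuadFactor m → ℚ → Set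
AtomsNearlyDecided A F ε =
  ∀ r s →
    let B = inAtom F r s
        b = count B
        a = count (λ x → A x ∧ B x)
    in 0 ℕ.< b →
       (ratio a b ℚ.< ε) ⊎ ((1ℚ ℚ.- ε) ℚ.< ratio a b)

IsRankFunction : (ℕ → ℚ) → Set
IsRankFunction ρ = (∀ n → 0ℚ ℚ.< ρ n) × (∀ m n → m ℕ.< n → ρ m ℚ.< ρ n)

QuadraticallyAtomic : ((m : ℕ) → Subset m → Set) → Set
QuadraticallyAtomic P =
  ∀ (ε : ℚ) → 0ℚ ℚ.< ε →
  ∀ (ρ : ℕ → ℚ) → IsRankFunction ρ →
  Σ ℕ λ D → Σ ℕ λ N →
    ∀ n → N ℕ.≤ n →
    ∀ m (A : Subset m) → P m A → 3 ^ n ℕ.≤ 3 ^ m →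
    Σ (QuadFactor m) λ F → Σ ℕ λ ℓ →
      HasDim (L F) ℓ × (ℓ + q F ℕ.≤ D) ×
      RankAtLeast F (ρ (ℓ + q F)) × AtomsNearlyDecided A F ε

-- A_GS(n,3) is the set of vectors whose first nonzero coordinate is 1.
--
-- No 4-HOP₂: isomorphisms of pairs are affine, so a 4-HOP₂ witness in a member of 𝒫_GS(3)
-- gives one in some A_GS(n,3), and in particular a witness of its sub-pattern
-- a_i + b_j + c_k ∈ A ⟺ i < j + k (i, j, k < 3). The leading coordinates of these 27 sums must
-- be compatible with the prescribed memberships, and an exhaustive check over the 3⁹ possible
-- leading coordinates of a, b, c shows that this forces all of them to vanish. So the pattern
-- descends to A_GS(n-1,3), and finally to A_GS(0,3) = ∅.
--
-- Not quadratically atomic: A_GS(m,3) contains exactly one of x and -x for every x ≠ 0. A factor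
-- of linear complexity ℓ < m leaves a nonzero x₀ orthogonal to all its linear forms, and the atom
-- of x₀ with linear values 0 is closed under negation. It therefore meets A_GS(m,3) in a of its
-- 2a + z points with a ≥ 1 and z ≤ 1, a density in [1/3, 1/2], never within ¼ of 0 or 1.

module Submission where

open import Defs
open import Data.Nat as ℕ using (ℕ; zero; suc; _+_; _*_; _^_; _≤_; _<_; z≤n; s≤s)
import Data.Nat.Properties as ℕP
open import Data.Nat.Tactic.RingSolver using (solve-∀)
open import Data.Fin using (Fin; zero; suc; toℕ; inject₁; combine; remQuot)
import Data.Fin.Properties as FinP
open import Data.Vec using (Vec; []; _∷_; map; head; tail; tabulate; lookup)
import Data.Vec.Properties as VecP
open import Data.Vec.Relation.Unary.All using (All; []; _∷_)
open import Data.List as List using (List; _++_)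
import Data.List.Properties as ListP
open import Data.Nat.ListAction using (sum)
open import Data.Nat.ListAction.Properties using (sum-++)
open import Data.Bool using (Bool; true; false; not; _∧_; _∨_; T; T?)
open import Data.Bool.Properties using (T-∧; ∧-identityʳ; ∧-zeroʳ)
open import Data.Product using (Σ; ∃-syntax; _×_; _,_; proj₁; proj₂)
open import Data.Sum using (_⊎_; inj₁; inj₂)
open import Data.Empty using (⊥-elim)
open import Data.Integer as ℤ using (+<+)
import Data.Integer.Properties as ℤP
open import Data.Rational as ℚ using (ℚ; _/_; 0ℚ; 1ℚ)
import Data.Rational.Properties as ℚP
open import Data.Rational.Unnormalised using (mkℚᵘ; *<*)
import Data.Rational.Unnormalised.Properties as ℚᵘP
open import Function using (_∘_; _⇔_; mk⇔; Equivalence)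
open import Function.Bundles using (Bijection)
open import Function.Construct.Identity using (⤖-id)
open import Relation.Nullary using (¬_; Dec; yes; no)
open import Relation.Nullary.Decidable using (⌊_⌋; from-yes; toWitness; dec-true; does-⇔; isYes≗does; _→-dec_)
open import Relation.Binary.PropositionalEquality

neg : ∀ {n} → V n → V n
neg = map -₃_

-₃-involutive : ∀ a → -₃ (-₃ a) ≡ a
-₃-involutive = from-yes (FinP.all? λ a → -₃ (-₃ a) FinP.≟ a)

+₃-identityʳ : ∀ a → a +₃ zero ≡ a
+₃-identityʳ = from-yes (FinP.all? λ a → a +₃ zero FinP.≟ a)

+₃-inverseʳ : ∀ a → a +₃ (-₃ a) ≡ zero
+₃-inverseʳ = from-yes (FinP.all? λ a → a +₃ (-₃ a) FinP.≟ zero)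

*₃-zeroʳ : ∀ a → a *₃ zero ≡ zero
*₃-zeroʳ = from-yes (FinP.all? λ a → a *₃ zero FinP.≟ zero)

x-y≡0⇒x≡y : ∀ a b → a +₃ (-₃ b) ≡ zero → a ≡ b
x-y≡0⇒x≡y = from-yes (FinP.all? λ a → FinP.all? λ b →
  (a +₃ (-₃ b) FinP.≟ zero) →-dec (a FinP.≟ b))

neg-involutive : ∀ {n} (x : V n) → neg (neg x) ≡ x
neg-involutive [] = refl
neg-involutive (a ∷ x) = cong₂ _∷_ (-₃-involutive a) (neg-involutive x)

neg-𝟎 : ∀ {n} → neg (𝟎 {n}) ≡ 𝟎
neg-𝟎 {n} = VecP.map-replicate -₃_ zero n

neg-≡𝟎 : ∀ {n} (x : V n) → neg x ≡ 𝟎 ⇔ x ≡ 𝟎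
neg-≡𝟎 x = mk⇔ (λ e → trans (sym (neg-involutive x)) (trans (cong neg e) neg-𝟎))
               (λ e → trans (cong neg e) neg-𝟎)

⊖𝟎 : ∀ {n} (x : V n) → x ⊖ 𝟎 ≡ x
⊖𝟎 [] = refl
⊖𝟎 (a ∷ x) = cong₂ _∷_ (+₃-identityʳ a) (⊖𝟎 x)

⊖≡𝟎⇒≡ : ∀ {n} (x y : V n) → x ⊖ y ≡ 𝟎 → x ≡ y
⊖≡𝟎⇒≡ [] [] _ = refl
⊖≡𝟎⇒≡ (a ∷ x) (b ∷ y) e =
  cong₂ _∷_ (x-y≡0⇒x≡y a b (VecP.∷-injectiveˡ e)) (⊖≡𝟎⇒≡ x y (VecP.∷-injectiveʳ e))

dot-⊕ˡ : ∀ {n} (x y z : V n) → dot (x ⊕ y) z ≡ dot x z +₃ dot y z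
dot-⊕ˡ [] [] [] = refl
dot-⊕ˡ (a ∷ x) (b ∷ y) (c ∷ z) =
  trans (cong (((a +₃ b) *₃ c) +₃_) (dot-⊕ˡ x y z)) (distrib a b c (dot x z) (dot y z))
  where
  distrib : ∀ a b c s t → ((a +₃ b) *₃ c) +₃ (s +₃ t) ≡ ((a *₃ c) +₃ s) +₃ ((b *₃ c) +₃ t)
  distrib = from-yes (FinP.all? λ a → FinP.all? λ b → FinP.all? λ c → FinP.all? λ s → FinP.all? λ t →
    ((a +₃ b) *₃ c) +₃ (s +₃ t) FinP.≟ ((a *₃ c) +₃ s) +₃ ((b *₃ c) +₃ t))

dot-⊕ʳ : ∀ {n} (x y z : V n) → dot x (y ⊕ z) ≡ dot x y +₃ dot x z
dot-⊕ʳ [] [] [] = refl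
dot-⊕ʳ (a ∷ x) (b ∷ y) (c ∷ z) =
  trans (cong ((a *₃ (b +₃ c)) +₃_) (dot-⊕ʳ x y z)) (distrib a b c (dot x y) (dot x z))
  where
  distrib : ∀ a b c s t → (a *₃ (b +₃ c)) +₃ (s +₃ t) ≡ ((a *₃ b) +₃ s) +₃ ((a *₃ c) +₃ t)
  distrib = from-yes (FinP.all? λ a → FinP.all? λ b → FinP.all? λ c → FinP.all? λ s → FinP.all? λ t →
    (a *₃ (b +₃ c)) +₃ (s +₃ t) FinP.≟ ((a *₃ b) +₃ s) +₃ ((a *₃ c) +₃ t))

dot-·ʳ : ∀ {n} (x : V n) c y → dot x (c · y) ≡ c *₃ dot x y
dot-·ʳ [] c [] = sym (*₃-zeroʳ c)
dot-·ʳ (a ∷ x) c (b ∷ y) =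
  trans (cong ((a *₃ (c *₃ b)) +₃_) (dot-·ʳ x c y)) (distrib a b c (dot x y))
  where
  distrib : ∀ a b c s → (a *₃ (c *₃ b)) +₃ (c *₃ s) ≡ c *₃ ((a *₃ b) +₃ s)
  distrib = from-yes (FinP.all? λ a → FinP.all? λ b → FinP.all? λ c → FinP.all? λ s →
    (a *₃ (c *₃ b)) +₃ (c *₃ s) FinP.≟ c *₃ ((a *₃ b) +₃ s))

dot-𝟎ʳ : ∀ {n} (x : V n) → dot x 𝟎 ≡ zero
dot-𝟎ʳ [] = refl
dot-𝟎ʳ (a ∷ x) = trans (cong ((a *₃ zero) +₃_) (dot-𝟎ʳ x)) (trans (+₃-identityʳ _) (*₃-zeroʳ a))

dot-negˡ : ∀ {n} (x y : V n) → dot (neg x) y ≡ -₃ dot x y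
dot-negˡ [] [] = refl
dot-negˡ (a ∷ x) (b ∷ y) = trans (cong (((-₃ a) *₃ b) +₃_) (dot-negˡ x y)) (distrib a b (dot x y))
  where
  distrib : ∀ a b s → ((-₃ a) *₃ b) +₃ (-₃ s) ≡ -₃ ((a *₃ b) +₃ s)
  distrib = from-yes (FinP.all? λ a → FinP.all? λ b → FinP.all? λ s →
    ((-₃ a) *₃ b) +₃ (-₃ s) FinP.≟ -₃ ((a *₃ b) +₃ s))

dot-negʳ : ∀ {n} (x y : V n) → dot x (neg y) ≡ -₃ dot x y
dot-negʳ [] [] = refl
dot-negʳ (a ∷ x) (b ∷ y) = trans (cong ((a *₃ (-₃ b)) +₃_) (dot-negʳ x y)) (distrib a b (dot x y))
  where
  distrib : ∀ a b s → (a *₃ (-₃ b)) +₃ (-₃ s) ≡ -₃ ((a *₃ b) +₃ s)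
  distrib = from-yes (FinP.all? λ a → FinP.all? λ b → FinP.all? λ s →
    (a *₃ (-₃ b)) +₃ (-₃ s) FinP.≟ -₃ ((a *₃ b) +₃ s))

matVec-neg : ∀ {m} (M : Mat m) (x : V m) → matVec M (neg x) ≡ neg (matVec M x)
matVec-neg M x = trans (VecP.tabulate-cong (λ i → dot-negʳ (tabulate (M i)) x))
                       (VecP.tabulate-∘ -₃_ (λ i → dot (tabulate (M i)) x))

quadForm-neg : ∀ {m} (x : V m) (M : Mat m) → quadForm (neg x) M ≡ quadForm x M
quadForm-neg x M = begin
  dot (neg x) (matVec M (neg x))  ≡⟨ cong (dot (neg x)) (matVec-neg M x) ⟩
  dot (neg x) (neg (matVec M x))  ≡⟨ dot-negˡ x _ ⟩
  -₃ dot x (neg (matVec M x))     ≡⟨ cong -₃_ (dot-negʳ x _) ⟩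
  -₃ (-₃ dot x (matVec M x))      ≡⟨ -₃-involutive _ ⟩
  dot x (matVec M x)              ∎
  where open ≡-Reasoning

-- A_GS(n,3) has no 4-HOP₂

Realises : ∀ {k m} → Subset m → (Fin k → Fin k → Fin k → Bool) → Set
Realises {k} {m} A p =
  Σ (Fin k → V m) λ a → Σ (Fin k → V m) λ b → Σ (Fin k → V m) λ c →
    ∀ u v w → A ((a u ⊕ b v) ⊕ c w) ≡ p u v w

hop : ∀ {k} → Fin k → Fin k → Fin k → Bool
hop u v w = ⌊ suc (toℕ u) ℕ.<? suc (toℕ v) + suc (toℕ w) ⌋

≡isYes : ∀ {b} {P : Set} (p? : Dec P) → (b ≡ true → P) → (P → b ≡ true) → b ≡ ⌊ p? ⌋
≡isYes (yes p) _ from = from p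
≡isYes {true} (no ¬p) to _ = ⊥-elim (¬p (to refl))
≡isYes {false} (no _) _ _ = refl

HasHOP₂⇒Realises-hop : ∀ {k m} {A : Subset m} → HasHOP₂ k m A → Realises A hop
HasHOP₂⇒Realises-hop (a , b , c , iff) =
  a , b , c , λ u v w → ≡isYes (_ ℕ.<? _) (proj₁ (iff u v w)) (proj₂ (iff u v w))

Realises-reindex : ∀ {j k m} {A : Subset m} {p : Fin k → Fin k → Fin k → Bool} (f g h : Fin j → Fin k) →
                   Realises A p → Realises A (λ u v w → p (f u) (g v) (h w))
Realises-reindex f g h (a , b , c , r) = a ∘ f , b ∘ g , c ∘ h , λ u v w → r (f u) (g v) (h w)

translate-cancel : ∀ {n} (x t y : V n) → ((((x ⊕ t) ⊕ t) ⊖ t) ⊕ y) ⊖ t ≡ x ⊕ y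
translate-cancel [] [] [] = refl
translate-cancel (a ∷ x) (d ∷ t) (b ∷ y) = cong₂ _∷_ (cancel a d b) (translate-cancel x t y)
  where
  cancel : ∀ a d b → ((((a +₃ d) +₃ d) +₃ (-₃ d)) +₃ b) +₃ (-₃ d) ≡ a +₃ b
  cancel = from-yes (FinP.all? λ a → FinP.all? λ d → FinP.all? λ b →
    ((((a +₃ d) +₃ d) +₃ (-₃ d)) +₃ b) +₃ (-₃ d) FinP.≟ a +₃ b)

Realises-transport : ∀ {k n m} {A : Subset n} {A′ : Subset m} {p : Fin k → Fin k → Fin k → Bool} →
                     PairIso n A m A′ → Realises A′ p → Realises A p
Realises-transport {n = n} {m} {A′ = A′} (f , hom , pres) (a , b , c , r) =
  from ∘ shift ∘ a , from ∘ b , from ∘ c ,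
  λ u v w → trans (sym (pres _)) (trans (cong A′ (to-sum u v w)) (r u v w))
  where
  open ≡-Reasoning
  to : V n → V m
  to = Bijection.to f
  from : V m → V n
  from y = proj₁ (Bijection.strictlySurjective f y)
  to-from : ∀ y → to (from y) ≡ y
  to-from y = proj₂ (Bijection.strictlySurjective f y)
  t : V m
  t = to 𝟎
  -- to (x ⊕ y) ≡ (to x ⊖ t) ⊕ to y, so each of the two additions in to-sum subtracts a t.
  shift : V m → V m
  shift x = (x ⊕ t) ⊕ t
  to-sum : ∀ u v w → to ((from (shift (a u)) ⊕ from (b v)) ⊕ from (c w)) ≡ (a u ⊕ b v) ⊕ c w
  to-sum u v w = begin
    to ((from (shift (a u)) ⊕ from (b v)) ⊕ from (c w))
      ≡⟨ hom _ _ ⟩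
    (to (from (shift (a u)) ⊕ from (b v)) ⊖ t) ⊕ to (from (c w))
      ≡⟨ cong₂ (λ s z → (s ⊖ t) ⊕ z) (hom _ _) (to-from (c w)) ⟩
    (((to (from (shift (a u))) ⊖ t) ⊕ to (from (b v))) ⊖ t) ⊕ c w
      ≡⟨ cong₂ (λ s z → (((s ⊖ t) ⊕ z) ⊖ t) ⊕ c w) (to-from _) (to-from (b v)) ⟩
    (((shift (a u) ⊖ t) ⊕ b v) ⊖ t) ⊕ c w
      ≡⟨ cong (_⊕ c w) (translate-cancel (a u) t (b v)) ⟩
    (a u ⊕ b v) ⊕ c w ∎

-- The part u ≥ 2, v ≤ 3, w ≤ 3 (1-indexed) of the 4-HOP₂ pattern, i.e. [i < j + k].
box : Fin 3 → Fin 3 → Fin 3 → Bool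
box i j k = hop (suc i) (inject₁ j) (inject₁ k)

headAllows : F₃ → Bool → Bool
headAllows zero _ = true
headAllows (suc zero) b = b
headAllows (suc (suc zero)) b = not b

headAllows-inAGS : ∀ {n} c (x : V n) → T (headAllows c (inAGS (c ∷ x)))
headAllows-inAGS zero x = _
headAllows-inAGS (suc zero) x = _
headAllows-inAGS (suc (suc zero)) x = _

all₃ : (Fin 3 → Bool) → Bool
all₃ p = p zero ∧ (p (suc zero) ∧ p (suc (suc zero)))

all₃-sound : ∀ p → T (all₃ p) → ∀ i → T (p i)
all₃-sound p h i = lookup₃ (Equivalence.to (T-∧ {p zero}) h) i
  where
  lookup₃ : T (p zero) × T (p (suc zero) ∧ p (suc (suc zero))) → ∀ i → T (p i)
  lookup₃ (h₀ , _) zero = h₀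
  lookup₃ (_ , h₁₂) (suc zero) = proj₁ (Equivalence.to (T-∧ {p (suc zero)}) h₁₂)
  lookup₃ (_ , h₁₂) (suc (suc zero)) = proj₂ (Equivalence.to (T-∧ {p (suc zero)}) h₁₂)

all₃-complete : ∀ p → (∀ i → T (p i)) → T (all₃ p)
all₃-complete p h =
  Equivalence.from (T-∧ {p zero}) (h zero , Equivalence.from (T-∧ {p (suc zero)}) (h (suc zero) , h (suc (suc zero))))

allBox : (Fin 3 → Fin 3 → Fin 3 → Bool) → Bool
allBox p = all₃ λ i → all₃ λ j → all₃ λ k → p i j k

allBox-sound : ∀ p → T (allBox p) → ∀ i j k → T (p i j k)
allBox-sound p h i j k = all₃-sound (p i j) (all₃-sound (λ j → all₃ (p i j)) (all₃-sound (λ i → all₃ λ j → all₃ (p i j)) h i) j) k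

allBox-complete : ∀ p → (∀ i j k → T (p i j k)) → T (allBox p)
allBox-complete p h = all₃-complete _ λ i → all₃-complete _ λ j → all₃-complete _ λ k → h i j k

boxHeadsVanish : (α β γ : Fin 3 → F₃) → Bool
boxHeadsVanish α β γ =
  not (allBox λ i j k → headAllows ((α i +₃ β j) +₃ γ k) (box i j k)) ∨
  allBox λ i j k → ⌊ (α i +₃ β j) +₃ γ k FinP.≟ zero ⌋

boxHeadsVanish-holds : ∀ α β γ → T (boxHeadsVanish α β γ)
boxHeadsVanish-holds α β γ =
  checked (α zero) (α (suc zero)) (α (suc (suc zero)))
          (β zero) (β (suc zero)) (β (suc (suc zero)))
          (γ zero) (γ (suc zero)) (γ (suc (suc zero)))
  where
  -- boxHeadsVanish α β γ only inspects α, β, γ at constant indices, so it is definitionally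
  -- the instance of checked at their values.
  vec₃ : F₃ → F₃ → F₃ → Fin 3 → F₃
  vec₃ x y z = lookup (x ∷ y ∷ z ∷ [])
  checked : ∀ a₀ a₁ a₂ b₀ b₁ b₂ c₀ c₁ c₂ → T (boxHeadsVanish (vec₃ a₀ a₁ a₂) (vec₃ b₀ b₁ b₂) (vec₃ c₀ c₁ c₂))
  checked = from-yes (FinP.all? λ a₀ → FinP.all? λ a₁ → FinP.all? λ a₂ →
                      FinP.all? λ b₀ → FinP.all? λ b₁ → FinP.all? λ b₂ →
                      FinP.all? λ c₀ → FinP.all? λ c₁ → FinP.all? λ c₂ →
                      T? (boxHeadsVanish (vec₃ a₀ a₁ a₂) (vec₃ b₀ b₁ b₂) (vec₃ c₀ c₁ c₂)))

heads-vanish : ∀ (α β γ : Fin 3 → F₃) →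
               (∀ i j k → T (headAllows ((α i +₃ β j) +₃ γ k) (box i j k))) →
               ∀ i j k → (α i +₃ β j) +₃ γ k ≡ zero
heads-vanish α β γ allowed i j k =
  toWitness (allBox-sound vanishes (implies (boxHeadsVanish-holds α β γ) (allBox-complete allows allowed)) i j k)
  where
  allows vanishes : Fin 3 → Fin 3 → Fin 3 → Bool
  allows i j k = headAllows ((α i +₃ β j) +₃ γ k) (box i j k)
  vanishes i j k = ⌊ (α i +₃ β j) +₃ γ k FinP.≟ zero ⌋
  implies : ∀ {a b} → T (not a ∨ b) → T a → T b
  implies {true} h _ = h

⊕-head-tail : ∀ {n} (x y z : V (suc n)) →
              (x ⊕ y) ⊕ z ≡ ((head x +₃ head y) +₃ head z) ∷ ((tail x ⊕ tail y) ⊕ tail z)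
⊕-head-tail (a ∷ x) (b ∷ y) (c ∷ z) = refl

inAGS-V0 : (x : V 0) → inAGS x ≡ false
inAGS-V0 [] = refl

AGS-¬Realises-box : ∀ n → ¬ Realises (inAGS {n}) box
AGS-¬Realises-box zero (a , b , c , r) with trans (sym (inAGS-V0 ((a zero ⊕ b zero) ⊕ c (suc zero)))) (r zero zero (suc zero))
... | ()
AGS-¬Realises-box (suc n) (a , b , c , r) = AGS-¬Realises-box n (tail ∘ a , tail ∘ b , tail ∘ c , r′)
  where
  h : Fin 3 → Fin 3 → Fin 3 → F₃
  h i j k = (head (a i) +₃ head (b j)) +₃ head (c k)
  rest : Fin 3 → Fin 3 → Fin 3 → V n
  rest i j k = (tail (a i) ⊕ tail (b j)) ⊕ tail (c k)
  split : ∀ i j k → inAGS (h i j k ∷ rest i j k) ≡ box i j k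
  split i j k = trans (cong inAGS (sym (⊕-head-tail (a i) (b j) (c k)))) (r i j k)
  vanish : ∀ i j k → h i j k ≡ zero
  vanish = heads-vanish (head ∘ a) (head ∘ b) (head ∘ c) λ i j k →
    subst (T ∘ headAllows (h i j k)) (split i j k) (headAllows-inAGS (h i j k) (rest i j k))
  r′ : ∀ i j k → inAGS (rest i j k) ≡ box i j k
  r′ i j k = trans (cong (λ d → inAGS (d ∷ rest i j k)) (sym (vanish i j k))) (split i j k)

PGS3-no-4-HOP₂ : (m : ℕ) (A : Subset m) → InPGS3 m A → ¬ HasHOP₂ 4 m A
PGS3-no-4-HOP₂ m A (n , _ , iso) hop₄ =
  AGS-¬Realises-box n (Realises-transport {A = inAGS} {A′ = A} iso
    (Realises-reindex {A = A} suc inject₁ inject₁ (HasHOP₂⇒Realises-hop {A = A} hop₄)))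

dot-⊖ˡ-≡0 : ∀ {m ℓ} (x y : V m) (ws : Vec (V m) ℓ) →
            map (dot x) ws ≡ map (dot y) ws → map (dot (x ⊖ y)) ws ≡ 𝟎
dot-⊖ˡ-≡0 x y [] _ = refl
dot-⊖ˡ-≡0 x y (w ∷ ws) e = cong₂ _∷_ head≡0 (dot-⊖ˡ-≡0 x y ws (VecP.∷-injectiveʳ e))
  where
  open ≡-Reasoning
  head≡0 : dot (x ⊖ y) w ≡ zero
  head≡0 = begin
    dot (x ⊖ y) w                 ≡⟨ dot-⊕ˡ x (neg y) w ⟩
    dot x w +₃ dot (neg y) w      ≡⟨ cong (dot x w +₃_) (dot-negˡ y w) ⟩
    dot x w +₃ (-₃ dot y w)       ≡⟨ cong (λ d → d +₃ (-₃ dot y w)) (VecP.∷-injectiveˡ e) ⟩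
    dot y w +₃ (-₃ dot y w)       ≡⟨ +₃-inverseʳ (dot y w) ⟩
    zero                          ∎

dot-lincomb-≡0 : ∀ {m ℓ} (x : V m) (ws : Vec (V m) ℓ) →
                 map (dot x) ws ≡ 𝟎 → ∀ c → dot x (lincomb c ws) ≡ zero
dot-lincomb-≡0 x [] _ [] = dot-𝟎ʳ x
dot-lincomb-≡0 x (w ∷ ws) x⊥ (c ∷ cs) = begin
  dot x ((c · w) ⊕ lincomb cs ws)         ≡⟨ dot-⊕ʳ x (c · w) _ ⟩
  dot x (c · w) +₃ dot x (lincomb cs ws)  ≡⟨ cong₂ _+₃_ (dot-·ʳ x c w)
                                              (dot-lincomb-≡0 x ws (VecP.∷-injectiveʳ x⊥) cs) ⟩
  (c *₃ dot x w) +₃ zero                  ≡⟨ cong (λ d → (c *₃ d) +₃ zero) (VecP.∷-injectiveˡ x⊥) ⟩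
  (c *₃ zero) +₃ zero                     ≡⟨ trans (+₃-identityʳ _) (*₃-zeroʳ c) ⟩
  zero                                    ∎
  where open ≡-Reasoning

⊥-span : ∀ {m ℓ k} (x : V m) (ws : Vec (V m) ℓ) (vs : Vec (V m) k) →
         map (dot x) ws ≡ 𝟎 → All (InSpan ws) vs → map (dot x) vs ≡ 𝟎
⊥-span x ws [] _ [] = refl
⊥-span x ws (v ∷ vs) x⊥ ((c , refl) ∷ vs∈span) =
  cong₂ _∷_ (dot-lincomb-≡0 x ws x⊥ c) (⊥-span x ws vs x⊥ vs∈span)

encode : ∀ {k} → V k → Fin (3 ^ k)
encode [] = zero
encode (c ∷ x) = combine c (encode x)

decode : ∀ k → Fin (3 ^ k) → V k
decode zero _ = []
decode (suc k) i = proj₁ (remQuot {3} (3 ^ k) i) ∷ decode k (proj₂ (remQuot {3} (3 ^ k) i))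

encode-injective : ∀ {k} (x y : V k) → encode x ≡ encode y → x ≡ y
encode-injective [] [] _ = refl
encode-injective (a ∷ x) (b ∷ y) e with FinP.combine-injective a (encode x) b (encode y) e
... | a≡b , ex≡ey = cong₂ _∷_ a≡b (encode-injective x y ex≡ey)

encode-decode : ∀ k (i : Fin (3 ^ k)) → encode (decode k i) ≡ i
encode-decode zero zero = refl
encode-decode (suc k) i =
  trans (cong (combine (proj₁ (remQuot {3} (3 ^ k) i))) (encode-decode k (proj₂ (remQuot {3} (3 ^ k) i)))) (FinP.combine-remQuot {3} (3 ^ k) i)

orthogonal-vector : ∀ {m ℓ} (ws : Vec (V m) ℓ) → ℓ < m → ∃[ x ] x ≢ 𝟎 × map (dot x) ws ≡ 𝟎
orthogonal-vector {m} ws ℓ<m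
  with FinP.pigeonhole (ℕP.^-monoʳ-< 3 (s≤s (s≤s z≤n)) ℓ<m) (λ i → encode (map (dot (decode m i)) ws))
... | i , j , i<j , same = decode m i ⊖ decode m j , nonzero , dot-⊖ˡ-≡0 (decode m i) (decode m j) ws (encode-injective _ _ same)
  where
  nonzero : decode m i ⊖ decode m j ≢ 𝟎
  nonzero e = FinP.<⇒≢ i<j (begin
    i                    ≡⟨ sym (encode-decode m i) ⟩
    encode (decode m i)  ≡⟨ cong encode (⊖≡𝟎⇒≡ _ _ e) ⟩
    encode (decode m j)  ≡⟨ encode-decode m j ⟩
    j                    ∎)
    where open ≡-Reasoning

indicator : Bool → ℕ
indicator true = 1
indicator false = 0

sum₃ : (F₃ → ℕ) → ℕ
sum₃ g = g zero + (g (suc zero) + g (suc (suc zero)))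

sumV : ∀ {m} → (V m → ℕ) → ℕ
sumV {zero} f = f []
sumV {suc m} f = sum₃ λ c → sumV (λ x → f (c ∷ x))

sum-map-allV : ∀ m (f : V m → ℕ) → sum (List.map f (allV m)) ≡ sumV f
sum-map-allV zero f = ℕP.+-identityʳ (f [])
sum-map-allV (suc m) f = begin
  total (slice zero ++ (slice (suc zero) ++ (slice (suc (suc zero)) ++ List.[])))
    ≡⟨ total-++ (slice zero) _ ⟩
  total (slice zero) + total (slice (suc zero) ++ (slice (suc (suc zero)) ++ List.[]))
    ≡⟨ cong (_+_ (total (slice zero))) (total-++ (slice (suc zero)) _) ⟩
  total (slice zero) + (total (slice (suc zero)) + total (slice (suc (suc zero)) ++ List.[]))
    ≡⟨ cong (λ t → total (slice zero) + (total (slice (suc zero)) + t))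
            (trans (total-++ (slice (suc (suc zero))) List.[]) (ℕP.+-identityʳ _)) ⟩
  total (slice zero) + (total (slice (suc zero)) + total (slice (suc (suc zero))))
    ≡⟨ cong₂ _+_ (total-slice zero) (cong₂ _+_ (total-slice (suc zero)) (total-slice (suc (suc zero)))) ⟩
  sumV f ∎
  where
  open ≡-Reasoning
  slice : F₃ → List (V (suc m))
  slice c = List.map (c ∷_) (allV m)
  total : List (V (suc m)) → ℕ
  total xs = sum (List.map f xs)
  total-++ : ∀ xs ys → total (xs ++ ys) ≡ total xs + total ys
  total-++ xs ys = trans (cong sum (ListP.map-++ f xs ys)) (sum-++ (List.map f xs) _)
  total-slice : ∀ c → total (slice c) ≡ sumV (λ x → f (c ∷ x))
  total-slice c = trans (cong sum (sym (ListP.map-∘ (allV m)))) (sum-map-allV m (λ x → f (c ∷ x)))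

length-filter-T? : ∀ {A : Set} (P : A → Bool) xs →
                   List.length (List.filter (λ x → T? (P x)) xs) ≡ sum (List.map (indicator ∘ P) xs)
length-filter-T? P List.[] = refl
length-filter-T? P (x List.∷ xs) with P x
... | true = cong suc (length-filter-T? P xs)
... | false = length-filter-T? P xs

count≡sumV : ∀ {m} (P : V m → Bool) → count P ≡ sumV (indicator ∘ P)
count≡sumV {m} P = trans (length-filter-T? P (allV m)) (sum-map-allV m (indicator ∘ P))

sum₃-cong : ∀ {g h : F₃ → ℕ} → (∀ c → g c ≡ h c) → sum₃ g ≡ sum₃ h
sum₃-cong e = cong₂ _+_ (e zero) (cong₂ _+_ (e (suc zero)) (e (suc (suc zero))))

sum₃-+ : ∀ (g h : F₃ → ℕ) → sum₃ (λ c → g c + h c) ≡ sum₃ g + sum₃ h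
sum₃-+ g h = interchange (g zero) (h zero) (g (suc zero)) (h (suc zero)) (g (suc (suc zero))) (h (suc (suc zero)))
  where
  interchange : ∀ a b c d e f → (a + b) + ((c + d) + (e + f)) ≡ (a + (c + e)) + (b + (d + f))
  interchange = solve-∀

sum₃-neg : ∀ (g : F₃ → ℕ) → sum₃ (g ∘ -₃_) ≡ sum₃ g
sum₃-neg g = cong (g zero +_) (ℕP.+-comm (g (suc (suc zero))) (g (suc zero)))

≤-sum₃ : ∀ (g : F₃ → ℕ) c → g c ≤ sum₃ g
≤-sum₃ g zero = ℕP.m≤m+n _ _
≤-sum₃ g (suc zero) = ℕP.≤-trans (ℕP.m≤m+n _ (g (suc (suc zero)))) (ℕP.m≤n+m _ (g zero))
≤-sum₃ g (suc (suc zero)) = ℕP.≤-trans (ℕP.m≤n+m _ (g (suc zero))) (ℕP.m≤n+m _ (g zero))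

sumV-cong : ∀ {m} {f g : V m → ℕ} → (∀ x → f x ≡ g x) → sumV f ≡ sumV g
sumV-cong {zero} e = e []
sumV-cong {suc m} e = sum₃-cong λ c → sumV-cong (λ x → e (c ∷ x))

sumV-+ : ∀ {m} (f g : V m → ℕ) → sumV (λ x → f x + g x) ≡ sumV f + sumV g
sumV-+ {zero} f g = refl
sumV-+ {suc m} f g = trans (sum₃-cong λ c → sumV-+ (λ x → f (c ∷ x)) (λ x → g (c ∷ x)))
  (sum₃-+ (λ c → sumV (λ x → f (c ∷ x))) (λ c → sumV (λ x → g (c ∷ x))))

sumV-neg : ∀ {m} (f : V m → ℕ) → sumV (f ∘ neg) ≡ sumV f
sumV-neg {zero} f = refl
sumV-neg {suc m} f = trans (sum₃-cong λ c → sumV-neg (λ x → f (-₃ c ∷ x)))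
                            (sum₃-neg (λ c → sumV (λ x → f (c ∷ x))))

≤-sumV : ∀ {m} (f : V m → ℕ) x → f x ≤ sumV f
≤-sumV {zero} f [] = ℕP.≤-refl
≤-sumV {suc m} f (c ∷ x) =
  ℕP.≤-trans (≤-sumV (λ y → f (c ∷ y)) x) (≤-sum₃ (λ c → sumV (λ y → f (c ∷ y))) c)

count-pos : ∀ {m} (P : V m → Bool) x → P x ≡ true → 1 ≤ count P
count-pos P x Px = subst (1 ≤_) (sym (count≡sumV P))
  (subst (λ b → indicator b ≤ sumV (indicator ∘ P)) Px (≤-sumV (indicator ∘ P) x))

sumV-0 : ∀ {m} → sumV {m} (λ _ → 0) ≡ 0
sumV-0 {zero} = refl
sumV-0 {suc m} rewrite sumV-0 {m} = refl

isZero : ∀ {n} → V n → Bool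
isZero [] = true
isZero (zero ∷ x) = isZero x
isZero (suc _ ∷ x) = false

sumV-isZero-∧ : ∀ {m} (B : V m → Bool) → sumV (λ x → indicator (isZero x ∧ B x)) ≡ indicator (B 𝟎)
sumV-isZero-∧ {zero} B = refl
sumV-isZero-∧ {suc m} B rewrite sumV-0 {m} =
  trans (ℕP.+-identityʳ _) (sumV-isZero-∧ (λ x → B (zero ∷ x)))

count-isZero-∧ : ∀ {m} (B : V m → Bool) → count (λ x → isZero x ∧ B x) ≤ 1
count-isZero-∧ B = subst (_≤ 1) (sym (trans (count≡sumV (λ x → isZero x ∧ B x)) (sumV-isZero-∧ B)))
                         (indicator≤1 (B 𝟎))
  where
  indicator≤1 : ∀ b → indicator b ≤ 1
  indicator≤1 true = ℕP.≤-refl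
  indicator≤1 false = z≤n

-- A_GS(n,3) splits F₃ⁿ ∖ {0} into a set and its negative

AGS-trichotomy : ∀ {n} (x : V n) →
                 indicator (inAGS x) + (indicator (inAGS (neg x)) + indicator (isZero x)) ≡ 1
AGS-trichotomy [] = refl
AGS-trichotomy (zero ∷ x) = AGS-trichotomy x
AGS-trichotomy (suc zero ∷ x) = refl
AGS-trichotomy (suc (suc zero) ∷ x) = refl

AGS-or-neg : ∀ {n} (x : V n) → x ≢ 𝟎 → inAGS x ≡ true ⊎ inAGS (neg x) ≡ true
AGS-or-neg [] x≢𝟎 = ⊥-elim (x≢𝟎 refl)
AGS-or-neg (zero ∷ x) x≢𝟎 = AGS-or-neg x (x≢𝟎 ∘ cong (zero ∷_))
AGS-or-neg (suc zero ∷ x) _ = inj₁ refl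
AGS-or-neg (suc (suc zero) ∷ x) _ = inj₂ refl

indicator-∧-partition : ∀ p q r b → indicator p + (indicator q + indicator r) ≡ 1 →
                        indicator b ≡ indicator (p ∧ b) + (indicator (q ∧ b) + indicator (r ∧ b))
indicator-∧-partition p q r true e
  rewrite ∧-identityʳ p | ∧-identityʳ q | ∧-identityʳ r = sym e
indicator-∧-partition p q r false e
  rewrite ∧-zeroʳ p | ∧-zeroʳ q | ∧-zeroʳ r = refl

module _ {m} (B : V m → Bool) (B-neg : ∀ x → B (neg x) ≡ B x) where

  count-AGS-symmetric :
    count B ≡ count (λ x → inAGS x ∧ B x) + (count (λ x → inAGS x ∧ B x) + count (λ x → isZero x ∧ B x))
  count-AGS-symmetric = begin
    count B
      ≡⟨ count≡sumV B ⟩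
    sumV (indicator ∘ B)
      ≡⟨ sumV-cong (λ x → indicator-∧-partition (inAGS x) (inAGS (neg x)) (isZero x) (B x) (AGS-trichotomy x)) ⟩
    sumV (λ x → a x + (a′ x + z x))
      ≡⟨ trans (sumV-+ a _) (cong (sumV a +_) (sumV-+ a′ z)) ⟩
    sumV a + (sumV a′ + sumV z)
      ≡⟨ cong (λ t → sumV a + (t + sumV z)) Σa′≡Σa ⟩
    sumV a + (sumV a + sumV z)
      ≡⟨ sym (cong₂ (λ s t → s + (s + t)) (count≡sumV (λ x → inAGS x ∧ B x)) (count≡sumV (λ x → isZero x ∧ B x))) ⟩
    count (λ x → inAGS x ∧ B x) + (count (λ x → inAGS x ∧ B x) + count (λ x → isZero x ∧ B x)) ∎
    where
    open ≡-Reasoning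
    a a′ z : V m → ℕ
    a x = indicator (inAGS x ∧ B x)
    a′ x = indicator (inAGS (neg x) ∧ B x)
    z x = indicator (isZero x ∧ B x)
    Σa′≡Σa : sumV a′ ≡ sumV a
    Σa′≡Σa = trans (sumV-cong λ x → cong (λ b → indicator (inAGS (neg x) ∧ b)) (sym (B-neg x))) (sumV-neg a)

  count-AGS-pos : ∀ x₀ → x₀ ≢ 𝟎 → B x₀ ≡ true → 1 ≤ count (λ x → inAGS x ∧ B x)
  count-AGS-pos x₀ x₀≢𝟎 x₀∈B with AGS-or-neg x₀ x₀≢𝟎
  ... | inj₁ x₀∈A = count-pos _ x₀ (cong₂ _∧_ x₀∈A x₀∈B)
  ... | inj₂ -x₀∈A = count-pos _ (neg x₀) (cong₂ _∧_ -x₀∈A (trans (B-neg x₀) x₀∈B))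

/<⇒*< : ∀ a b c d → (ℤ.+ a / suc b) ℚ.< (ℤ.+ c / suc d) → a * suc d < c * suc b
/<⇒*< a b c d h
  with ℚᵘP.<-respˡ-≃ (ℚP.toℚᵘ-fromℚᵘ (mkℚᵘ (ℤ.+ a) b))
         (ℚᵘP.<-respʳ-≃ (ℚP.toℚᵘ-fromℚᵘ (mkℚᵘ (ℤ.+ c) d)) (ℚP.toℚᵘ-mono-< h))
... | *<* ad<cb rewrite sym (ℤP.pos-* a (suc d)) | sym (ℤP.pos-* c (suc b)) with ad<cb
... | +<+ r = r

*<⇒/< : ∀ a b c d → a * suc d < c * suc b → (ℤ.+ a / suc b) ℚ.< (ℤ.+ c / suc d)
*<⇒/< a b c d h = ℚP.toℚᵘ-cancel-<
  (ℚᵘP.<-respˡ-≃ (ℚᵘP.≃-sym (ℚP.toℚᵘ-fromℚᵘ (mkℚᵘ (ℤ.+ a) b)))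
    (ℚᵘP.<-respʳ-≃ (ℚᵘP.≃-sym (ℚP.toℚᵘ-fromℚᵘ (mkℚᵘ (ℤ.+ c) d))) (*<* ad<cb)))
  where
  ad<cb : ℤ.+ a ℤ.* ℤ.+ suc d ℤ.< ℤ.+ c ℤ.* ℤ.+ suc b
  ad<cb rewrite sym (ℤP.pos-* a (suc d)) | sym (ℤP.pos-* c (suc b)) = +<+ h

¼ : ℚ
¼ = ℤ.+ 1 / 4

¼-undecided : ∀ a z → 1 ≤ a → z ≤ 1 →
              ¬ (ratio a (a + (a + z)) ℚ.< ¼ ⊎ (1ℚ ℚ.- ¼) ℚ.< ratio a (a + (a + z)))
¼-undecided (suc a) z _ z≤1 (inj₁ h) =
  ℕP.<-irrefl refl (ℕP.<-≤-trans (/<⇒*< c (a + (c + z)) 1 3 h) b≤4c)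
  where
  open ℕP.≤-Reasoning
  c : ℕ
  c = suc a
  b≤4c : 1 * (c + (c + z)) ≤ c * 4
  b≤4c = begin
    1 * (c + (c + z))   ≡⟨ ℕP.*-identityˡ _ ⟩
    c + (c + z)         ≤⟨ ℕP.+-monoʳ-≤ c (ℕP.+-monoʳ-≤ c (ℕP.≤-trans z≤1 (s≤s z≤n))) ⟩
    c + (c + (c + c))   ≡⟨ four c ⟩
    c * 4               ∎
    where
    four : ∀ c → c + (c + (c + c)) ≡ c * 4
    four = solve-∀
-- 1ℚ ℚ.- ¼ normalises to 3/4.
¼-undecided (suc a) z _ z≤1 (inj₂ h) =
  ℕP.<-irrefl refl (ℕP.<-≤-trans (/<⇒*< 3 3 c (a + (c + z)) h) 4c≤3b)
  where
  open ℕP.≤-Reasoning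
  c : ℕ
  c = suc a
  4c≤3b : c * 4 ≤ 3 * (c + (c + z))
  4c≤3b = begin
    c * 4               ≤⟨ ℕP.m≤m+n (c * 4) (c * 2) ⟩
    c * 4 + c * 2       ≡⟨ six c ⟩
    3 * (c + c)         ≤⟨ ℕP.*-monoʳ-≤ 3 (ℕP.+-monoʳ-≤ c (ℕP.m≤m+n c z)) ⟩
    3 * (c + (c + z))   ∎
    where
    six : ∀ c → c * 4 + c * 2 ≡ 3 * (c + c)
    six = solve-∀

-- A_GS(n,3) is not quadratically atomic

isYes-⇔ : ∀ {A B : Set} → A ⇔ B → (a? : Dec A) (b? : Dec B) → ⌊ a? ⌋ ≡ ⌊ b? ⌋
isYes-⇔ A⇔B a? b? = trans (isYes≗does a?) (trans (does-⇔ A⇔B a? b?) (sym (isYes≗does b?)))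

module _ {m} (F : QuadFactor m) where

  zeroAtom-neg : ∀ s x → inAtom F 𝟎 s (neg x) ≡ inAtom F 𝟎 s x
  zeroAtom-neg s x = cong₂ _∧_ linear quadratic
    where
    linear : ⌊ map (dot (neg x)) (L F) ≟V 𝟎 ⌋ ≡ ⌊ map (dot x) (L F) ≟V 𝟎 ⌋
    linear = trans (cong (λ u → ⌊ u ≟V 𝟎 ⌋) (trans (VecP.map-cong (dot-negˡ x) (L F)) (VecP.map-∘ -₃_ (dot x) (L F))))
                   (isYes-⇔ (neg-≡𝟎 _) _ _)
    quadratic : ⌊ map (quadForm (neg x)) (Q F) ≟V s ⌋ ≡ ⌊ map (quadForm x) (Q F) ≟V s ⌋
    quadratic = cong (λ u → ⌊ u ≟V s ⌋) (VecP.map-cong (quadForm-neg x) (Q F))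

  zeroAtom-∋ : ∀ x → map (dot x) (L F) ≡ 𝟎 → inAtom F 𝟎 (map (quadForm x) (Q F)) x ≡ true
  zeroAtom-∋ x x⊥L = cong₂ _∧_ (trans (cong (λ u → ⌊ u ≟V 𝟎 ⌋) x⊥L) (reflexive 𝟎)) (reflexive _)
    where
    reflexive : ∀ {k} (u : V k) → ⌊ u ≟V u ⌋ ≡ true
    reflexive u = trans (isYes≗does (u ≟V u)) (dec-true (u ≟V u) refl)

  AGS-not-¼-decided : ∀ x₀ → x₀ ≢ 𝟎 → map (dot x₀) (L F) ≡ 𝟎 → ¬ AtomsNearlyDecided inAGS F ¼
  AGS-not-¼-decided x₀ x₀≢𝟎 x₀⊥L decided =
    subst (λ b → ¬ (ratio a b ℚ.< ¼ ⊎ (1ℚ ℚ.- ¼) ℚ.< ratio a b)) (sym |B|≡)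
      (¼-undecided a _ 1≤a (count-isZero-∧ B))
      (decided 𝟎 s (subst (0 <_) (sym |B|≡) (ℕP.≤-trans 1≤a (ℕP.m≤m+n a _))))
    where
    s : Vec F₃ (q F)
    s = map (quadForm x₀) (Q F)
    B : V m → Bool
    B = inAtom F 𝟎 s
    B-neg : ∀ x → B (neg x) ≡ B x
    B-neg = zeroAtom-neg s
    a : ℕ
    a = count (λ x → inAGS x ∧ B x)
    |B|≡ : count B ≡ a + (a + count (λ x → isZero x ∧ B x))
    |B|≡ = count-AGS-symmetric B B-neg
    1≤a : 1 ≤ a
    1≤a = count-AGS-pos B B-neg x₀ x₀≢𝟎 (zeroAtom-∋ x₀ x₀⊥L)

PairIso-refl : ∀ {m} (A : Subset m) → PairIso m A m A
PairIso-refl {m} A = ⤖-id (V m) , (λ x y → cong (_⊕ y) (sym (⊖𝟎 x))) , (λ x → refl)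

¼-pos : 0ℚ ℚ.< ¼
¼-pos = *<⇒/< 0 0 1 3 (s≤s z≤n)

-- Any rank function will do: the argument never uses the rank of the factor.
ρ : ℕ → ℚ
ρ n = ℤ.+ suc n / 1

ρ-isRankFunction : IsRankFunction ρ
ρ-isRankFunction = (λ n → *<⇒/< 0 0 (suc n) 0 (s≤s z≤n))
                 , (λ m n m<n → *<⇒/< (suc m) 0 (suc n) 0 (ℕP.*-monoˡ-< 1 (s≤s m<n)))

PGS3-not-quadratically-atomic : ¬ QuadraticallyAtomic InPGS3
PGS3-not-quadratically-atomic qa with qa ¼ ¼-pos ρ ρ-isRankFunction
... | D , N , atomic
  with atomic N ℕP.≤-refl (suc (N + D)) inAGS (suc (N + D) , s≤s z≤n , PairIso-refl inAGS)
              (ℕP.^-monoʳ-≤ 3 (ℕP.≤-trans (ℕP.m≤m+n N D) (ℕP.n≤1+n _)))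
... | F , ℓ , (ws , _ , _ , L∈span) , ℓ+q≤D , _ , decided
  with orthogonal-vector ws (s≤s (ℕP.≤-trans (ℕP.m≤m+n ℓ (q F)) (ℕP.≤-trans ℓ+q≤D (ℕP.m≤n+m D N))))
... | x₀ , x₀≢𝟎 , x₀⊥ws = AGS-not-¼-decided F x₀ x₀≢𝟎 (⊥-span x₀ ws (L F) x₀⊥ws L∈span) decided

proposition1p27 : ((m : ℕ) (A : Subset m) → InPGS3 m A → ¬ HasHOP₂ 4 m A) ×
    ¬ QuadraticallyAtomic InPGS3
proposition1p27 = PGS3-no-4-HOP₂ , PGS3-not-quadratically-atomic
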